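{- Let $G$ be a connected non-bipartite graph with an edge $(x,y)$ such that $G':=G\setminus(x,y)$ (edge deletion) is connected and bipartite. Then $\mathcal{N}(G')$ is the disjoint union of two connected components $A$ and $B$, where the faces $N_{G'}(x)$ and $N_{G'}(y)$ lie in $A$ and the vertices $x,y$ lie in $B$.
   Context: The neighborhood complex $\mathcal{N}(G)$ is the simplicial complex on $V(G)$ whose faces are all subsets of the sets $N_G(v)$, $v\in V(G)$, where $N_G(v)$ is the set of neighbors of $v$. -}

module Defs where

open import Level using (0ℓ)
open import Data.Nat using (ℕ)
open import Data.Bool using (Bool)
open import Data.Fin using (Fin)
open import Data.Fin.Subset using (Subset; _∈_; ⁅_⁆; _∪_)
open import Data.Product using (Σ; ∃; _×_; _,_)
open import Relation.Nullary using (¬_)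
open import Relation.Binary.PropositionalEquality using (_≡_; _≢_)
open import Relation.Binary.Construct.Closure.ReflexiveTransitive using (Star)

record Graph (n : ℕ) : Set₁ where
  field
    Adj     : Fin n → Fin n → Set
    sym     : ∀ {u v} → Adj u v → Adj v u
    irrefl  : ∀ {u} → ¬ Adj u u
open Graph public

deleteEdge : ∀ {n} → Graph n → Fin n → Fin n → Graph n
deleteEdge {n} G x y = record
  { Adj    = A
  ; sym    = λ { (a , p , q) → sym G a , (λ { (e1 , e2) → q (e2 , e1) }) , (λ { (e1 , e2) → p (e2 , e1) }) }
  ; irrefl = λ { (a , _ , _) → irrefl G a }
  }
  where
  A : Fin n → Fin n → Set
  A u v = Adj G u v × ¬ (u ≡ x × v ≡ y) × ¬ (u ≡ y × v ≡ x)

Connected : ∀ {n} → Graph n → Set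
Connected G = ∀ u v → Star (Adj G) u v

Bipartite : ∀ {n} → Graph n → Set
Bipartite {n} G = Σ (Fin n → Bool) λ c → ∀ {u v} → Adj G u v → c u ≢ c v

-- N_G(v) as a predicate: u ∈ N_G(v) iff Adj G v u.
-- Faces of the neighbourhood complex N(G): subsets of some N_G(v).
IsNbhdFace : ∀ {n} → Graph n → Subset n → Set
IsNbhdFace {n} G σ = ∃ λ (v : Fin n) → ∀ u → u ∈ σ → Adj G v u

NVertex : ∀ {n} → Graph n → Fin n → Set
NVertex G u = IsNbhdFace G ⁅ u ⁆

NEdge : ∀ {n} → Graph n → Fin n → Fin n → Set
NEdge G u v = u ≢ v × IsNbhdFace G (⁅ u ⁆ ∪ ⁅ v ⁆)

NConn : ∀ {n} → Graph n → Fin n → Fin n → Set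
NConn G = Star (NEdge G)

-- Fix a proper 2-colouring c of the bipartite graph G' = G \ (x,y). Two vertices of
-- N(G') joined by an edge have a common neighbour, so they have the same colour; conversely,
-- since G' is connected, any two vertices of the same colour are joined by a walk of even
-- length, and each two-step piece u – w – v of it is an edge (or a loop) of N(G').  Hence
-- the components of N(G') are exactly the two colour classes.  The edge (x,y) would complete
-- c to a proper colouring of G unless c x ≡ c y, so x and y share a class B, while the
-- neighbours of x and of y form the other class A.
module Submission where

open import Defs
open import Data.Bool using (Bool; not)
open import Data.Bool.Properties using (¬-not) renaming (_≟_ to _≟ᵇ_)
open import Data.Fin using (Fin; _≟_)
open import Data.Fin.Subset using (⁅_⁆; _∪_)
open import Data.Fin.Subset.Properties using (x∈⁅y⁆⇒x≡y; x∈⁅x⁆; x∈p∪q⁻; x∈p∪q⁺)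
open import Data.Product using (Σ; ∃; _×_; _,_)
open import Data.Sum using (_⊎_; inj₁; inj₂; [_,_])
open import Data.Empty using (⊥-elim)
open import Function using (_∘_)
open import Relation.Nullary using (¬_; yes; no)
open import Relation.Nullary.Decidable using (_×-dec_)
open import Relation.Binary.PropositionalEquality
  using (_≡_; _≢_; refl; trans; subst; ≢-sym; module ≡-Reasoning) renaming (sym to ≡-sym)
open import Relation.Binary.Construct.Closure.ReflexiveTransitive using (Star; ε; _◅_; _◅◅_)

ProperColouring : ∀ {n} → Graph n → (Fin n → Bool) → Set
ProperColouring G c = ∀ {u v} → Adj G u v → c u ≢ c v

∃-firstStep : ∀ {A : Set} {R : A → A → Set} {x y : A} → Star R x y → x ≢ y → ∃ (R x)
∃-firstStep ε         x≢x = ⊥-elim (x≢x refl)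
∃-firstStep (r ◅ _)   _   = _ , r

module NeighbourhoodComplex {n} (H : Graph n) where

  neighbour⇒NVertex : ∀ {w u} → Adj H w u → NVertex H u
  neighbour⇒NVertex {w} {u} wu = w , λ z z∈⁅u⁆ → subst (Adj H w) (≡-sym (x∈⁅y⁆⇒x≡y u z∈⁅u⁆)) wu

  commonNeighbour⇒NFace : ∀ {w u v} → Adj H w u → Adj H w v → IsNbhdFace H (⁅ u ⁆ ∪ ⁅ v ⁆)
  commonNeighbour⇒NFace {w} {u} {v} wu wv = w , λ z z∈σ →
    [ (λ z∈⁅u⁆ → subst (Adj H w) (≡-sym (x∈⁅y⁆⇒x≡y u z∈⁅u⁆)) wu)
    , (λ z∈⁅v⁆ → subst (Adj H w) (≡-sym (x∈⁅y⁆⇒x≡y v z∈⁅v⁆)) wv)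
    ] (x∈p∪q⁻ ⁅ u ⁆ ⁅ v ⁆ z∈σ)

  commonNeighbour⇒NConn : ∀ {w u v} → Adj H w u → Adj H w v → NConn H u v
  commonNeighbour⇒NConn {u = u} {v} wu wv with u ≟ v
  ... | yes refl = ε
  ... | no u≢v   = (u≢v , commonNeighbour⇒NFace wu wv) ◅ ε

  NEdge⇒commonNeighbour : ∀ {u v} → NEdge H u v → ∃ λ w → Adj H w u × Adj H w v
  NEdge⇒commonNeighbour {u} {v} (_ , w , face) =
    w , face u (x∈p∪q⁺ (inj₁ (x∈⁅x⁆ u))) , face v (x∈p∪q⁺ {p = ⁅ u ⁆} (inj₂ (x∈⁅x⁆ v)))

module Bipartite-NeighbourhoodComplex
  {n} (H : Graph n) (c : Fin n → Bool) (proper : ProperColouring H c) where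

  open NeighbourhoodComplex H
  open ≡-Reasoning

  adj⇒oppositeColour : ∀ {u v} → Adj H u v → c v ≡ not (c u)
  adj⇒oppositeColour uv = ¬-not (≢-sym (proper uv))

  commonNeighbour⇒sameColour : ∀ {w u v} → Adj H w u → Adj H w v → c u ≡ c v
  commonNeighbour⇒sameColour {w} {u} {v} wu wv = begin
    c u        ≡⟨ adj⇒oppositeColour wu ⟩
    not (c w)  ≡⟨ adj⇒oppositeColour wv ⟨
    c v        ∎

  NConn⇒sameColour : ∀ {u v} → NConn H u v → c u ≡ c v
  NConn⇒sameColour ε       = refl
  NConn⇒sameColour (e ◅ r) with NEdge⇒commonNeighbour e
  ... | _ , wu , wv = trans (commonNeighbour⇒sameColour wu wv) (NConn⇒sameColour r)

  -- Walks between equally coloured vertices have even length; they are consumed two steps at a time.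
  walk⇒NConn : ∀ {u v} → Star (Adj H) u v → c u ≡ c v → NConn H u v
  walk⇒NConn ε                 _   = ε
  walk⇒NConn (uv ◅ ε)          cu≡cv = ⊥-elim (proper uv cu≡cv)
  walk⇒NConn (uw ◅ ww′ ◅ rest) cu≡cv =
    commonNeighbour⇒NConn (Graph.sym H uw) ww′
      ◅◅ walk⇒NConn rest (trans (≡-sym (commonNeighbour⇒sameColour (Graph.sym H uw) ww′)) cu≡cv)

  module WhenConnected (connected : Connected H) where

    sameColour⇒NConn : ∀ {u v} → c u ≡ c v → NConn H u v
    sameColour⇒NConn {u} {v} = walk⇒NConn (connected u v)

    NConn-dichotomy : ∀ {w a} → Adj H w a → ∀ v → NConn H v a ⊎ NConn H v w
    NConn-dichotomy {w} {a} wa v with c v ≟ᵇ c w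
    ... | yes cv≡cw = inj₂ (sameColour⇒NConn cv≡cw)
    ... | no  cv≢cw = inj₁ (sameColour⇒NConn (trans (¬-not cv≢cw) (≡-sym (adj⇒oppositeColour wa))))

deleteEdge-proper : ∀ {n} (G : Graph n) x y {c : Fin n → Bool} →
  ProperColouring (deleteEdge G x y) c → c x ≢ c y → ProperColouring G c
deleteEdge-proper G x y {c} proper cx≢cy {u} {v} uv
  with (u ≟ x) ×-dec (v ≟ y) | (u ≟ y) ×-dec (v ≟ x)
... | yes (refl , refl) | _                 = cx≢cy
... | no _              | yes (refl , refl) = cx≢cy ∘ ≡-sym
... | no ¬xy            | no ¬yx            = proper (uv , ¬xy , ¬yx)

nonBipartite-deleteEdge-sameColour : ∀ {n} (G : Graph n) x y {c : Fin n → Bool} →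
  ¬ Bipartite G → ProperColouring (deleteEdge G x y) c → c x ≡ c y
nonBipartite-deleteEdge-sameColour G x y {c} nonbip proper with c x ≟ᵇ c y
... | yes cx≡cy = cx≡cy
... | no  cx≢cy = ⊥-elim (nonbip (c , deleteEdge-proper G x y proper cx≢cy))

lemma3p2 : ∀ {n} (G : Graph n) (x y : Fin n) →
    Connected G → ¬ Bipartite G → Adj G x y →
    Connected (deleteEdge G x y) → Bipartite (deleteEdge G x y) →
    Σ (Fin n) λ a → Σ (Fin n) λ b →
      NVertex (deleteEdge G x y) a × NVertex (deleteEdge G x y) b ×
      ¬ NConn (deleteEdge G x y) a b ×
      (∀ v → NVertex (deleteEdge G x y) v →
        NConn (deleteEdge G x y) v a ⊎ NConn (deleteEdge G x y) v b) ×
      (∀ u → Adj (deleteEdge G x y) x u → NConn (deleteEdge G x y) u a) ×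
      (∀ u → Adj (deleteEdge G x y) y u → NConn (deleteEdge G x y) u a) ×
      NConn (deleteEdge G x y) x b × NConn (deleteEdge G x y) y b
lemma3p2 G x y _ nonbip xy connected′ (c , proper)
  with ∃-firstStep (connected′ x y) (λ { refl → irrefl G xy })
... | a , xa =
  a , x , neighbour⇒NVertex xa , neighbour⇒NVertex (Graph.sym G′ xa)
  , (λ a~x → proper xa (≡-sym (NConn⇒sameColour a~x)))
  , (λ v _ → NConn-dichotomy xa v)
  , (λ u xu → oppositeTo-x⇒NConn-a (adj⇒oppositeColour xu))
  , (λ u yu → oppositeTo-x⇒NConn-a (subst (λ b → c u ≡ not b) (≡-sym cx≡cy) (adj⇒oppositeColour yu)))
  , ε , sameColour⇒NConn (≡-sym cx≡cy)
  where
  G′ : Graph _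
  G′ = deleteEdge G x y
  open NeighbourhoodComplex G′
  open Bipartite-NeighbourhoodComplex G′ c proper
  open WhenConnected connected′

  cx≡cy : c x ≡ c y
  cx≡cy = nonBipartite-deleteEdge-sameColour G x y nonbip proper

  oppositeTo-x⇒NConn-a : ∀ {u} → c u ≡ not (c x) → NConn G′ u a
  oppositeTo-x⇒NConn-a cu≡¬cx = sameColour⇒NConn (trans cu≡¬cx (≡-sym (adj⇒oppositeColour xa)))
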